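{- Let $G$ be a finite simple graph with maximum degree $\Delta_G$, and let $L$ be the square of the line graph of $G$. Then the clique number $\omega(L)$ of $L$ is at most $1.5\,\Delta_G^2$.
   Context: The line graph of $G$ is the graph whose vertices are the edges of $G$, two being adjacent iff the corresponding edges of $G$ share an endpoint. The square of a graph $H$ is the graph on $V(H)$ in which two distinct vertices are adjacent iff their distance in $H$ is at most $2$. Equivalently, a clique in $L$ is a set of edges of $G$ such that any two of them either share an endpoint or are joined by an edge of $G$ (i.e. some endpoint of one is adjacent in $G$ to some endpoint of the other). The clique number $\omega(L)$ is the maximum size of a clique in $L$. -}

module Defs where

open import Data.Nat using (ℕ; _⊔_; _<_)
open import Data.Fin using (Fin; toℕ)
open import Data.Product using (Σ; _×_; _,_; proj₁; proj₂)
open import Data.Sum using (_⊎_)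
open import Data.List using (List; length; filter; allFin; map; foldr)
open import Data.List.Relation.Unary.AllPairs using (AllPairs)
open import Relation.Nullary using (¬_; Dec)
open import Relation.Binary.PropositionalEquality using (_≡_; _≢_)

record Graph (n : ℕ) : Set₁ where
  field
    Adj      : Fin n → Fin n → Set
    adj?     : ∀ u v → Dec (Adj u v)
    sym      : ∀ {u v} → Adj u v → Adj v u
    irrefl   : ∀ {u} → ¬ Adj u u
open Graph public

degree : ∀ {n} (G : Graph n) → Fin n → ℕ
degree G v = length (filter (adj? G v) (allFin _))

maxDegree : ∀ {n} (G : Graph n) → ℕ
maxDegree G = foldr _⊔_ 0 (map (degree G) (allFin _))

-- An edge of G: an unordered pair {u,v}, represented canonically as (u , v)
-- with toℕ u < toℕ v and u adjacent to v.
Edge : ∀ {n} → Graph n → Set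
Edge {n} G = Σ (Fin n) λ u → Σ (Fin n) λ v → (toℕ u < toℕ v) × Adj G u v

src tgt : ∀ {n} (G : Graph n) → Edge G → Fin n
src G e = proj₁ e
tgt G e = proj₁ (proj₂ e)

DistinctEdges : ∀ {n} (G : Graph n) → Edge G → Edge G → Set
DistinctEdges G e f = ¬ ((src G e ≡ src G f) × (tgt G e ≡ tgt G f))

-- Edges e,f are adjacent in the square of the line graph iff they share an
-- endpoint or an endpoint of one is adjacent in G to an endpoint of the other.
CloseEdges : ∀ {n} (G : Graph n) → Edge G → Edge G → Set
CloseEdges {n} G e f =
  Σ (Fin n) λ x → Σ (Fin n) λ y →
    ((x ≡ src G e) ⊎ (x ≡ tgt G e)) × ((y ≡ src G f) ⊎ (y ≡ tgt G f)) ×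
    ((x ≡ y) ⊎ Adj G x y)

IsLClique : ∀ {n} (G : Graph n) → List (Edge G) → Set
IsLClique G es = AllPairs (λ e f → DistinctEdges G e f × CloseEdges G e f) es

module Submission where

-- Let u be a vertex met by the largest number k of clique edges, write Δ for the
-- maximum degree, and call a clique edge far if neither endpoint is adjacent to u.
-- Every other clique edge has an endpoint in N(u), and each vertex meets at most k
-- clique edges, so there are at most Δk of them. For a vertex z let ℓ(z) count the
-- clique edges at u whose other endpoint is adjacent to z, and q(z) the far edges at z.
-- Sending these edges to their endpoint other than z (resp. u) is injective into N(z),
-- so q(z) + ℓ(z) ≤ Δ; moreover Σ ℓ ≤ Δk, and since a far edge xy can only be reached
-- from an edge at u through that edge's other endpoint, ℓ(x) + ℓ(y) ≥ k. Hence, with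
-- the weights w(z) = ℓ(z) / (Δ − ℓ(z)),
--   (#far) · 2k / (2Δ − k) ≤ Σ_{far xy} (w(x) + w(y)) = Σ_z q(z) w(z) ≤ Σ_z ℓ(z) ≤ Δk,
-- the first step by convexity of t ↦ t / (Δ − t). So there are at most Δ(2Δ − k)/2 far
-- edges, and the clique has at most Δk + Δ(2Δ − k)/2 = Δ² + Δk/2 ≤ 1.5 Δ² edges.

open import Defs hiding (sym)
open import Data.Nat using (ℕ; _*_; _≤_)
open import Data.List using (List; length)

open import Data.Nat using (zero; suc; _+_; _∸_; _<_; _⊔_; _!; z≤n; s≤s; NonZero; >-nonZero)
open import Data.Nat.Properties hiding (_≟_)
open import Data.Nat.Divisibility using (∣-trans; m∣m*n; m≤n⇒m!∣n!)
open import Data.Nat.DivMod using (_/_; m*[n/m]≡n)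
open import Data.Nat.Tactic.RingSolver using (solve; solve-∀)
open import Data.Fin using (Fin; zero; suc; toℕ)
open import Data.Fin.Properties as Finₚ using (_≟_)
open import Data.List using ([]; _∷_; filter; tabulate; foldr; allFin; lookup)
open import Data.List.Membership.Propositional using (_∈_)
open import Data.List.Membership.Propositional.Properties using (∈-allFin; ∈-map⁺; ∈-lookup)
open import Data.List.Relation.Unary.Any using (here; there)
open import Data.List.Relation.Unary.All as All using ()
open import Data.List.Relation.Unary.AllPairs using (AllPairs; _∷_)
open import Data.List.Extrema.Nat using (argmax; f[xs]≤f[argmax]; f[⊥]≤f[argmax])
open import Data.Product using (Σ; _×_; _,_; proj₁; proj₂)
open import Data.Sum using (_⊎_; inj₁; inj₂; [_,_]′)
open import Data.Empty using (⊥; ⊥-elim)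
open import Function using (id)
open import Relation.Nullary using (Dec; yes; no; ¬_; ¬?; _×-dec_; _⊎-dec_)
open import Relation.Nullary.Decidable using (map′)
open import Relation.Unary using (Decidable)
open import Relation.Unary.Properties using (_∪?_)
open import Relation.Binary.PropositionalEquality
  using (_≡_; _≢_; refl; sym; trans; cong; cong₂; subst; subst₂; module ≡-Reasoning)
open import Algebra.Properties.CommutativeSemigroup *-commutativeSemigroup using (x∙yz≈y∙xz)
open import Algebra.Properties.Semiring.Sum +-*-semiring
  using (sum-syntax; sum-remove; sum-cong-≗; sum-replicate-zero;
         ∑-comm; ∑-distrib-+; *-distribˡ-sum; *-distribʳ-sum)

private variable
  P Q R : Set
  m n : ℕ

𝟙 : Dec P → ℕ
𝟙 (yes _) = 1
𝟙 (no _)  = 0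

𝟙≤1 : (p? : Dec P) → 𝟙 p? ≤ 1
𝟙≤1 (yes _) = s≤s z≤n
𝟙≤1 (no _)  = z≤n

𝟙-yes : (p? : Dec P) → P → 𝟙 p? ≡ 1
𝟙-yes (yes _) _ = refl
𝟙-yes (no ¬p) p = ⊥-elim (¬p p)

𝟙-pos : (p? : Dec P) → 1 ≤ 𝟙 p? → P
𝟙-pos (yes p) _ = p

𝟙-cover : (p? : Dec P) (q? : Dec Q) (r? : Dec R) → (P → Q ⊎ R) → 𝟙 p? ≤ 𝟙 q? + 𝟙 r?
𝟙-cover (no _)  _       _       _ = z≤n
𝟙-cover (yes p) (yes _) _       _ = s≤s z≤n
𝟙-cover (yes p) (no ¬q) (yes _) _ = s≤s z≤n
𝟙-cover (yes p) (no ¬q) (no ¬r) f with f p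
... | inj₁ q = ⊥-elim (¬q q)
... | inj₂ r = ⊥-elim (¬r r)

𝟙-mono : (p? : Dec P) (q? : Dec Q) → (P → Q) → 𝟙 p? ≤ 𝟙 q?
𝟙-mono (no _)  _       _ = z≤n
𝟙-mono (yes _) (yes _) _ = s≤s z≤n
𝟙-mono (yes p) (no ¬q) f = ⊥-elim (¬q (f p))

𝟙-*-mono : ∀ {a b} (p? : Dec P) → (P → a ≤ b) → 𝟙 p? * a ≤ 𝟙 p? * b
𝟙-*-mono (yes p) a≤b = *-monoʳ-≤ 1 (a≤b p)
𝟙-*-mono (no _)  _   = z≤n

𝟙-× : (p? : Dec P) (q? : Dec Q) → 𝟙 (p? ×-dec q?) ≡ 𝟙 p? * 𝟙 q?
𝟙-× (yes _) (yes _) = refl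
𝟙-× (yes _) (no _)  = refl
𝟙-× (no _)  _       = refl

𝟙-⊎ : (p? : Dec P) (q? : Dec Q) → ¬ (P × Q) → 𝟙 (p? ⊎-dec q?) ≡ 𝟙 p? + 𝟙 q?
𝟙-⊎ (yes p) (yes q) disjoint = ⊥-elim (disjoint (p , q))
𝟙-⊎ (yes _) (no _)  _        = refl
𝟙-⊎ (no _)  (yes _) _        = refl
𝟙-⊎ (no _)  (no _)  _        = refl

𝟙-map′ : ∀ {f : P → Q} {g : Q → P} (p? : Dec P) → 𝟙 (map′ f g p?) ≡ 𝟙 p?
𝟙-map′ (yes _) = refl
𝟙-map′ (no _)  = refl

∑-mono-≤ : {f g : Fin n → ℕ} → (∀ i → f i ≤ g i) → ∑[ i < n ] f i ≤ ∑[ i < n ] g i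
∑-mono-≤ {zero}  _   = z≤n
∑-mono-≤ {suc n} f≤g = +-mono-≤ (f≤g zero) (∑-mono-≤ (λ i → f≤g (suc i)))

∑-zero : (f : Fin n → ℕ) → (∀ i → f i ≤ 0) → ∑[ i < n ] f i ≤ 0
∑-zero {n} f f≤0 = ≤-trans (∑-mono-≤ f≤0) (≤-reflexive (sum-replicate-zero n))

∑1≡n : ∀ n → ∑[ i < n ] 1 ≡ n
∑1≡n zero    = refl
∑1≡n (suc n) = cong suc (∑1≡n n)

term≤∑ : (f : Fin n → ℕ) (i : Fin n) → f i ≤ ∑[ j < n ] f j
term≤∑ {suc n} f i = subst (f i ≤_) (sym (sum-remove {i = i} f)) (m≤m+n (f i) _)

∑-δ : (x : Fin n) (h : Fin n → ℕ) → ∑[ z < n ] (𝟙 (z ≟ x) * h z) ≡ h x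
∑-δ {suc n} zero h =
  trans (cong₂ _+_ (*-identityˡ (h zero)) (sum-replicate-zero n)) (+-identityʳ (h zero))
∑-δ {suc n} (suc x) h =
  trans (sum-cong-≗ (λ z → cong (_* h (suc z)) (𝟙-map′ (z ≟ x)))) (∑-δ x (λ z → h (suc z)))

∑-≤1 : {f : Fin n → ℕ} → (∀ i → f i ≤ 1) → (∀ {i j} → 1 ≤ f i → 1 ≤ f j → i ≡ j) →
       ∑[ i < n ] f i ≤ 1
∑-≤1 {zero}      _   _      = z≤n
∑-≤1 {suc n} {f} f≤1 unique with f zero ≤? 0
... | yes f₀≤0 = +-mono-≤ f₀≤0 (∑-≤1 (λ i → f≤1 (suc i)) λ p q → Finₚ.suc-injective (unique p q))
... | no  f₀≰0 = +-mono-≤ (f≤1 zero) (∑-zero (λ i → f (suc i)) λ i → ≮⇒≥ λ p → Finₚ.0≢1+n (unique (≰⇒> f₀≰0) p))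

count : {P : Fin n → Set} → Decidable P → ℕ
count {n} P? = ∑[ i < n ] 𝟙 (P? i)

module _ {P : Fin n → Set} (P? : Decidable P) where

  count-pos : ∀ {i} → P i → 1 ≤ count P?
  count-pos {i} p = subst (_≤ count P?) (𝟙-yes (P? i) p) (term≤∑ (λ j → 𝟙 (P? j)) i)

  count-mono : {Q : Fin n → Set} (Q? : Decidable Q) → (∀ {i} → P i → Q i) → count P? ≤ count Q?
  count-mono Q? P⊆Q = ∑-mono-≤ λ i → 𝟙-mono (P? i) (Q? i) P⊆Q

  count-cover : {Q R : Fin n → Set} (Q? : Decidable Q) (R? : Decidable R) →
                (∀ {i} → P i → Q i ⊎ R i) → count P? ≤ count Q? + count R?
  count-cover Q? R? cover = begin
    ∑[ i < n ] 𝟙 (P? i)              ≤⟨ ∑-mono-≤ (λ i → 𝟙-cover (P? i) (Q? i) (R? i) cover) ⟩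
    ∑[ i < n ] (𝟙 (Q? i) + 𝟙 (R? i)) ≡⟨ ∑-distrib-+ (λ i → 𝟙 (Q? i)) (λ i → 𝟙 (R? i)) ⟩
    count Q? + count R?              ∎
    where open ≤-Reasoning

  count-∪ : {Q : Fin n → Set} (Q? : Decidable Q) → (∀ {i} → P i → Q i → ⊥) → count (P? ∪? Q?) ≡ count P? + count Q?
  count-∪ Q? disjoint = begin
    ∑[ i < n ] 𝟙 (P? i ⊎-dec Q? i)       ≡⟨ sum-cong-≗ (λ i → 𝟙-⊎ (P? i) (Q? i) λ (p , q) → disjoint p q) ⟩
    ∑[ i < n ] (𝟙 (P? i) + 𝟙 (Q? i))      ≡⟨ ∑-distrib-+ (λ i → 𝟙 (P? i)) (λ i → 𝟙 (Q? i)) ⟩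
    count P? + count Q?                  ∎
    where open ≡-Reasoning

module _ {P : Fin m → Set} {T : Fin n → Set} (P? : Decidable P) (T? : Decidable T)
         (φ : ∀ i → P i → Fin n) (φ∈T : ∀ i (p : P i) → T (φ i p))
         (φ-injective : ∀ {i j} (p : P i) (q : P j) → φ i p ≡ φ j q → i ≡ j) where

  private
    hit : ∀ i → Dec (P i) → Fin n → ℕ
    hit i (yes p) w = 𝟙 (w ≟ φ i p)
    hit i (no _)  _ = 0

    ∑-hit : ∀ i (p? : Dec (P i)) → ∑[ w < n ] hit i p? w ≡ 𝟙 p?
    ∑-hit i (yes p) = trans (sum-cong-≗ {x = hit i (yes p)} λ w → sym (*-identityʳ _)) (∑-δ (φ i p) (λ _ → 1))
    ∑-hit i (no _)  = sum-replicate-zero n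

    hit≤1 : ∀ i (p? : Dec (P i)) w → hit i p? w ≤ 1
    hit≤1 i (yes p) w = 𝟙≤1 (w ≟ φ i p)
    hit≤1 i (no _)  w = z≤n

    hit-pos : ∀ i (p? : Dec (P i)) w → 1 ≤ hit i p? w → Σ (P i) λ p → w ≡ φ i p
    hit-pos i (yes p) w h = p , 𝟙-pos (w ≟ φ i p) h

    ∑-column : ∀ w → ∑[ i < m ] hit i (P? i) w ≤ 𝟙 (T? w)
    ∑-column w with T? w
    ... | yes _ = ∑-≤1 (λ i → hit≤1 i (P? i) w) λ {i} {j} hᵢ hⱼ →
      let p , w≡φᵢ = hit-pos i (P? i) w hᵢ
          q , w≡φⱼ = hit-pos j (P? j) w hⱼ
      in φ-injective p q (trans (sym w≡φᵢ) w≡φⱼ)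
    ... | no ¬t = ∑-zero _ λ i → ≮⇒≥ λ h →
      let p , w≡φᵢ = hit-pos i (P? i) w h in ¬t (subst T (sym w≡φᵢ) (φ∈T i p))

  count-≤-injection : count P? ≤ count T?
  count-≤-injection = begin
    ∑[ i < m ] 𝟙 (P? i)                ≡⟨ sum-cong-≗ (λ i → ∑-hit i (P? i)) ⟨
    ∑[ i < m ] ∑[ w < n ] hit i (P? i) w ≡⟨ ∑-comm (λ i w → hit i (P? i) w) ⟩
    ∑[ w < n ] ∑[ i < m ] hit i (P? i) w ≤⟨ ∑-mono-≤ ∑-column ⟩
    ∑[ w < n ] 𝟙 (T? w)                ∎
    where open ≤-Reasoning

4*m*n≤[m+n]² : ∀ a b → 4 * (a * b) ≤ (a + b) * (a + b)
4*m*n≤[m+n]² a b = [ ordered , swapped ]′ (≤-total a b)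
  where
  ordered : ∀ {a b} → a ≤ b → 4 * (a * b) ≤ (a + b) * (a + b)
  ordered {a} a≤b with m≤n⇒∃[o]m+o≡n a≤b
  ... | c , refl = begin
    4 * (a * (a + c))                  ≤⟨ m≤m+n _ (c * c) ⟩
    4 * (a * (a + c)) + c * c          ≡⟨ solve (a ∷ c ∷ []) ⟩
    (a + (a + c)) * (a + (a + c))      ∎
    where open ≤-Reasoning
  swapped : b ≤ a → 4 * (a * b) ≤ (a + b) * (a + b)
  swapped b≤a = subst₂ _≤_ (cong (4 *_) (*-comm b a)) (cong (λ s → s * s) (+-comm b a)) (ordered b≤a)

-- With d = a + x = b + y and T = 2d − k, this is x/a + y/b ≥ 2k/T without denominators:
-- it follows from 1/a + 1/b ≥ 4/(a + b) and a + b ≤ T.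
2kab≤T[xb+ya] : ∀ {a b x y k T} → b + y ≡ a + x → k ≤ x + y → T + k ≡ 2 * (a + x) →
                2 * k * (a * b) ≤ T * (x * b + y * a)
2kab≤T[xb+ya] {a} {b} {x} {y} {k} {T} b+y≡a+x k≤x+y T+k≡2d =
  +-cancelʳ-≤ (2 * T * (a * b)) _ _ (begin
    2 * k * (a * b) + 2 * T * (a * b) ≡⟨ solve (a ∷ b ∷ k ∷ T ∷ []) ⟩
    2 * (T + k) * (a * b)             ≡⟨ cong (λ s → 2 * s * (a * b)) T+k≡2d ⟩
    2 * (2 * (a + x)) * (a * b)       ≡⟨ solve (a ∷ b ∷ x ∷ []) ⟩
    (a + x) * (4 * (a * b))           ≤⟨ *-monoʳ-≤ (a + x) (4*m*n≤[m+n]² a b) ⟩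
    (a + x) * ((a + b) * (a + b))     ≤⟨ *-monoʳ-≤ (a + x) (*-monoʳ-≤ (a + b) a+b≤T) ⟩
    (a + x) * ((a + b) * T)           ≡⟨ solve (a ∷ b ∷ x ∷ T ∷ []) ⟩
    T * ((a + x) * b + (a + x) * a)   ≡⟨ cong (λ s → T * ((a + x) * b + s * a)) (sym b+y≡a+x) ⟩
    T * ((a + x) * b + (b + y) * a)   ≡⟨ solve (a ∷ b ∷ x ∷ y ∷ T ∷ []) ⟩
    T * (x * b + y * a) + 2 * T * (a * b) ∎)
  where
  open ≤-Reasoning
  a+b≤T : a + b ≤ T
  a+b≤T = +-cancelʳ-≤ k (a + b) T (begin
    a + b + k           ≤⟨ +-monoʳ-≤ (a + b) k≤x+y ⟩
    a + b + (x + y)     ≡⟨ solve (a ∷ b ∷ x ∷ y ∷ []) ⟩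
    (a + x) + (b + y)   ≡⟨ cong ((a + x) +_) b+y≡a+x ⟩
    (a + x) + (a + x)   ≡⟨ solve (a ∷ x ∷ []) ⟩
    2 * (a + x)         ≡⟨ T+k≡2d ⟨
    T + k               ∎)

2kD≤T[xA+yB] : ∀ {a b x y k T A B D} .{{_ : NonZero a}} .{{_ : NonZero b}} →
               b + y ≡ a + x → k ≤ x + y → T + k ≡ 2 * (a + x) → a * A ≡ D → b * B ≡ D →
               2 * k * D ≤ T * (x * A + y * B)
2kD≤T[xA+yB] {a} {b} {x} {y} {k} {T} {A} {B} b+y≡a+x k≤x+y T+k≡2d refl bB≡aA =
  *-cancelʳ-≤ _ _ (a * b) {{m*n≢0 a b}} (begin
    2 * k * (a * A) * (a * b)               ≡⟨ solve (a ∷ b ∷ k ∷ A ∷ []) ⟩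
    2 * k * (a * b) * (a * A)               ≤⟨ *-monoˡ-≤ (a * A) (2kab≤T[xb+ya] {a} {b} {x} {y} b+y≡a+x k≤x+y T+k≡2d) ⟩
    T * (x * b + y * a) * (a * A)           ≡⟨ solve (a ∷ b ∷ x ∷ y ∷ T ∷ A ∷ []) ⟩
    T * (x * b * (a * A) + y * a * (a * A)) ≡⟨ cong (λ s → T * (x * b * (a * A) + y * a * s)) (sym bB≡aA) ⟩
    T * (x * b * (a * A) + y * a * (b * B)) ≡⟨ solve (a ∷ b ∷ x ∷ y ∷ T ∷ A ∷ B ∷ []) ⟩
    T * (x * A + y * B) * (a * b)           ∎)
  where open ≤-Reasoning

m*[n!/m]≡n! : ∀ {a d} .{{_ : NonZero a}} → a ≤ d → a * (d ! / a) ≡ d !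
m*[n!/m]≡n! {suc a} a≤d = m*[n/m]≡n (∣-trans (m∣m*n (a !)) (m≤n⇒m!∣n! a≤d))

length-filter-tabulate : ∀ {A : Set} {P : A → Set} (P? : Decidable P) (f : Fin n → A) →
                         length (filter P? (tabulate f)) ≡ ∑[ i < n ] 𝟙 (P? (f i))
length-filter-tabulate {zero}  P? f = refl
length-filter-tabulate {suc n} P? f with P? (f zero)
... | yes _ = cong suc (length-filter-tabulate P? (λ i → f (suc i)))
... | no  _ = length-filter-tabulate P? (λ i → f (suc i))

∈⇒≤foldr-⊔ : ∀ {x xs} → x ∈ xs → x ≤ foldr _⊔_ 0 xs
∈⇒≤foldr-⊔ {xs = y ∷ _} (here refl) = m≤m⊔n y _
∈⇒≤foldr-⊔ {xs = y ∷ _} (there x∈xs) = m≤n⇒m≤o⊔n y (∈⇒≤foldr-⊔ x∈xs)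

lookup-pairwise : ∀ {A : Set} {R : A → A → Set} → (∀ x y → R x y → R y x) →
                  ∀ {xs} → AllPairs R xs → ∀ {i j} → i ≢ j → R (lookup xs i) (lookup xs j)
lookup-pairwise R-sym (_  ∷ _)   {zero}  {zero}  0≢0 = ⊥-elim (0≢0 refl)
lookup-pairwise R-sym (Rx ∷ _)   {zero}  {suc j} _   = All.lookup Rx (∈-lookup j)
lookup-pairwise R-sym (Rx ∷ _)   {suc i} {zero}  _   = R-sym _ _ (All.lookup Rx (∈-lookup i))
lookup-pairwise R-sym (_  ∷ Rxs) {suc i} {suc j} i≢j = lookup-pairwise R-sym Rxs (λ i≡j → i≢j (cong suc i≡j))

module Edges {n : ℕ} (G : Graph n) where

  _∈ᵉ_ : Fin n → Edge G → Set
  z ∈ᵉ e = z ≡ src G e ⊎ z ≡ tgt G e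

  _∈ᵉ?_ : ∀ z e → Dec (z ∈ᵉ e)
  z ∈ᵉ? e = z ≟ src G e ⊎-dec z ≟ tgt G e

  src<tgt : ∀ e → toℕ (src G e) < toℕ (tgt G e)
  src<tgt (_ , _ , s<t , _) = s<t

  src~tgt : ∀ e → Adj G (src G e) (tgt G e)
  src~tgt (_ , _ , _ , s~t) = s~t

  src≢tgt : ∀ e → src G e ≢ tgt G e
  src≢tgt e s≡t = <-irrefl (cong toℕ s≡t) (src<tgt e)

  opposite : Fin n → Edge G → Fin n
  opposite z e with z ≟ src G e
  ... | yes _ = tgt G e
  ... | no  _ = src G e

  opposite-∈ᵉ : ∀ z e → opposite z e ∈ᵉ e
  opposite-∈ᵉ z e with z ≟ src G e
  ... | yes _ = inj₂ refl
  ... | no  _ = inj₁ refl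

  opposite-spec : ∀ {z e} → z ∈ᵉ e →
    (z ≡ src G e × opposite z e ≡ tgt G e) ⊎ (z ≡ tgt G e × opposite z e ≡ src G e)
  opposite-spec {z} {e} z∈e with z ≟ src G e | z∈e
  ... | yes z≡s | _        = inj₁ (z≡s , refl)
  ... | no  z≢s | inj₁ z≡s = ⊥-elim (z≢s z≡s)
  ... | no  _   | inj₂ z≡t = inj₂ (z≡t , refl)

  opposite-adj : ∀ {z e} → z ∈ᵉ e → Adj G z (opposite z e)
  opposite-adj {z} {e} z∈e with opposite-spec z∈e
  ... | inj₁ (z≡s , o≡t) = subst₂ (Adj G) (sym z≡s) (sym o≡t) (src~tgt e)
  ... | inj₂ (z≡t , o≡s) = subst₂ (Adj G) (sym z≡t) (sym o≡s) (Graph.sym G (src~tgt e))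

  ∈ᵉ-opposite : ∀ {z p e} → z ∈ᵉ e → p ∈ᵉ e → p ≡ z ⊎ p ≡ opposite z e
  ∈ᵉ-opposite z∈e p∈e with opposite-spec z∈e | p∈e
  ... | inj₁ (z≡s , _)   | inj₁ p≡s = inj₁ (trans p≡s (sym z≡s))
  ... | inj₁ (_   , o≡t) | inj₂ p≡t = inj₂ (trans p≡t (sym o≡t))
  ... | inj₂ (_   , o≡s) | inj₁ p≡s = inj₂ (trans p≡s (sym o≡s))
  ... | inj₂ (z≡t , _)   | inj₂ p≡t = inj₁ (trans p≡t (sym z≡t))

  ¬reversed : ∀ e f → src G e ≡ tgt G f → tgt G e ≡ src G f → ⊥
  ¬reversed e f sₑ≡t tₑ≡s =
    <-asym (src<tgt e) (subst₂ _<_ (cong toℕ (sym tₑ≡s)) (cong toℕ (sym sₑ≡t)) (src<tgt f))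

  opposite-injective : ∀ {z e f} → z ∈ᵉ e → z ∈ᵉ f → opposite z e ≡ opposite z f →
                       src G e ≡ src G f × tgt G e ≡ tgt G f
  opposite-injective {z} {e} {f} z∈e z∈f o≡o′ with opposite-spec z∈e | opposite-spec z∈f
  ... | inj₁ (z≡s , o≡t) | inj₁ (z≡s′ , o′≡t′) = trans (sym z≡s) z≡s′ , trans (sym o≡t) (trans o≡o′ o′≡t′)
  ... | inj₂ (z≡t , o≡s) | inj₂ (z≡t′ , o′≡s′) = trans (sym o≡s) (trans o≡o′ o′≡s′) , trans (sym z≡t) z≡t′
  ... | inj₁ (z≡s , o≡t) | inj₂ (z≡t′ , o′≡s′) =
    ⊥-elim (¬reversed e f (trans (sym z≡s) z≡t′) (trans (sym o≡t) (trans o≡o′ o′≡s′)))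
  ... | inj₂ (z≡t , o≡s) | inj₁ (z≡s′ , o′≡t′) =
    ⊥-elim (¬reversed f e (trans (sym z≡s′) z≡t) (trans (sym o′≡t′) (trans (sym o≡o′) o≡s)))

  count-adj≤maxDegree : ∀ v → count (adj? G v) ≤ maxDegree G
  count-adj≤maxDegree v = subst (_≤ maxDegree G) (length-filter-tabulate (adj? G v) id)
    (∈⇒≤foldr-⊔ (∈-map⁺ (degree G) (∈-allFin v)))

  ∑-∈ᵉ : ∀ e (h : Fin n → ℕ) → ∑[ z < n ] (𝟙 (z ∈ᵉ? e) * h z) ≡ h (src G e) + h (tgt G e)
  ∑-∈ᵉ e h = begin
    ∑[ z < n ] (𝟙 (z ∈ᵉ? e) * h z)
      ≡⟨ sum-cong-≗ (λ z → trans (cong (_* h z) (𝟙-⊎ (z ≟ src G e) (z ≟ tgt G e) ends-distinct))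
                                 (*-distribʳ-+ (h z) (𝟙 (z ≟ src G e)) (𝟙 (z ≟ tgt G e)))) ⟩
    ∑[ z < n ] (𝟙 (z ≟ src G e) * h z + 𝟙 (z ≟ tgt G e) * h z)
      ≡⟨ ∑-distrib-+ (λ z → 𝟙 (z ≟ src G e) * h z) (λ z → 𝟙 (z ≟ tgt G e) * h z) ⟩
    ∑[ z < n ] (𝟙 (z ≟ src G e) * h z) + ∑[ z < n ] (𝟙 (z ≟ tgt G e) * h z)
      ≡⟨ cong₂ _+_ (∑-δ (src G e) h) (∑-δ (tgt G e) h) ⟩
    h (src G e) + h (tgt G e) ∎
    where
    open ≡-Reasoning
    ends-distinct : ∀ {z} → z ≡ src G e × z ≡ tgt G e → ⊥
    ends-distinct (z≡s , z≡t) = src≢tgt e (trans (sym z≡s) z≡t)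

module EdgeFamily {n m : ℕ} (G : Graph n) (e : Fin m → Edge G) where
  open Edges G

  load : Fin n → ℕ
  load z = count (λ j → z ∈ᵉ? e j)

  loadWithin : {Q : Fin m → Set} → Decidable Q → Fin n → ℕ
  loadWithin Q? z = count (λ j → Q? j ×-dec z ∈ᵉ? e j)

  ∑-endpoints : (g : Fin m → ℕ) (h : Fin n → ℕ) →
    ∑[ j < m ] (g j * (h (src G (e j)) + h (tgt G (e j)))) ≡
    ∑[ z < n ] (∑[ j < m ] (g j * 𝟙 (z ∈ᵉ? e j)) * h z)
  ∑-endpoints g h = begin
    ∑[ j < m ] (g j * (h (src G (e j)) + h (tgt G (e j))))
      ≡⟨ sum-cong-≗ (λ j → cong (g j *_) (sym (∑-∈ᵉ (e j) h))) ⟩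
    ∑[ j < m ] (g j * ∑[ z < n ] (𝟙 (z ∈ᵉ? e j) * h z))
      ≡⟨ sum-cong-≗ (λ j → *-distribˡ-sum (g j) (λ z → 𝟙 (z ∈ᵉ? e j) * h z)) ⟩
    ∑[ j < m ] ∑[ z < n ] (g j * (𝟙 (z ∈ᵉ? e j) * h z))
      ≡⟨ ∑-comm (λ j z → g j * (𝟙 (z ∈ᵉ? e j) * h z)) ⟩
    ∑[ z < n ] ∑[ j < m ] (g j * (𝟙 (z ∈ᵉ? e j) * h z))
      ≡⟨ sum-cong-≗ (λ z → sum-cong-≗ λ j → sym (*-assoc (g j) _ (h z))) ⟩
    ∑[ z < n ] ∑[ j < m ] (g j * 𝟙 (z ∈ᵉ? e j) * h z)
      ≡⟨ sum-cong-≗ (λ z → *-distribʳ-sum (h z) (λ j → g j * 𝟙 (z ∈ᵉ? e j))) ⟨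
    ∑[ z < n ] (∑[ j < m ] (g j * 𝟙 (z ∈ᵉ? e j)) * h z) ∎
    where open ≡-Reasoning

  module HeavyEdges {Q : Fin m → Set} (Q? : Decidable Q) (i : Fin n → ℕ) {d k : ℕ}
           (1≤k : 1 ≤ k) (k≤2d : k ≤ 2 * d)
           (room : ∀ z → loadWithin Q? z + i z ≤ d)
           (heavy : ∀ {j} → Q j → k ≤ i (src G (e j)) + i (tgt G (e j)))
           (∑i≤dk : ∑[ z < n ] i z ≤ d * k) where

    T : ℕ
    T = 2 * d ∸ k

    T+k≡2d : T + k ≡ 2 * d
    T+k≡2d = m∸n+n≡m k≤2d

    -- d − i z, shifted so that it is never zero; it agrees with d ∸ i z whenever
    -- i z < d, the only case in which it is used.
    slack : Fin n → ℕ
    slack z = suc (d ∸ suc (i z))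

    share : Fin n → ℕ
    share z = d ! / slack z

    -- d ! times the fractional weight i z / (d − i z).
    weight : Fin n → ℕ
    weight z = i z * share z

    slack+i≡d : ∀ {z} → i z < d → slack z + i z ≡ d
    slack+i≡d {z} i<d = trans (sym (+-suc (d ∸ suc (i z)) (i z))) (m∸n+n≡m i<d)

    slack*share≡d! : ∀ {z} → i z < d → slack z * share z ≡ d !
    slack*share≡d! {z} i<d = m*[n!/m]≡n! (subst (slack z ≤_) (slack+i≡d i<d) (m≤m+n (slack z) (i z)))

    loaded⇒i<d : ∀ {z} → 1 ≤ loadWithin Q? z → i z < d
    loaded⇒i<d {z} 1≤load = ≤-trans (+-monoˡ-≤ (i z) 1≤load) (room z)

    load*weight≤i*d! : ∀ z → loadWithin Q? z * weight z ≤ i z * d !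
    load*weight≤i*d! z with i z <? d
    ... | no i≮d = ≤-trans (*-monoˡ-≤ (weight z) (≮⇒≥ λ 1≤load → i≮d (loaded⇒i<d 1≤load))) z≤n
    ... | yes i<d = begin
      loadWithin Q? z * (i z * share z) ≤⟨ *-monoˡ-≤ (weight z) load≤slack ⟩
      slack z * (i z * share z)         ≡⟨ x∙yz≈y∙xz (slack z) (i z) (share z) ⟩
      i z * (slack z * share z)         ≡⟨ cong (i z *_) (slack*share≡d! i<d) ⟩
      i z * d !                         ∎
      where
      open ≤-Reasoning
      load≤slack : loadWithin Q? z ≤ slack z
      load≤slack = +-cancelʳ-≤ (i z) _ _ (subst (loadWithin Q? z + i z ≤_) (sym (slack+i≡d i<d)) (room z))

    heavy-weight : ∀ {j} → Q j → 2 * k * d ! ≤ T * (weight (src G (e j)) + weight (tgt G (e j)))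
    heavy-weight {j} q = 2kD≤T[xA+yB] {a = slack (src G (e j))} {b = slack (tgt G (e j))}
      (trans (slack+i≡d i<d-tgt) (sym (slack+i≡d i<d-src)))
      (heavy q)
      (subst (λ x → T + k ≡ 2 * x) (sym (slack+i≡d i<d-src)) T+k≡2d)
      (slack*share≡d! i<d-src) (slack*share≡d! i<d-tgt)
      where
      i<d : ∀ {z} → z ∈ᵉ e j → i z < d
      i<d {z} z∈e = loaded⇒i<d (count-pos (λ j′ → Q? j′ ×-dec z ∈ᵉ? e j′) (q , z∈e))
      i<d-src : i (src G (e j)) < d
      i<d-src = i<d (inj₁ refl)
      i<d-tgt : i (tgt G (e j)) < d
      i<d-tgt = i<d (inj₂ refl)

    weighted-count : count Q? * (2 * k * d !) ≤ T * (d * k * d !)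
    weighted-count = begin
      count Q? * (2 * k * d !)
        ≡⟨ *-distribʳ-sum (2 * k * d !) (λ j → 𝟙 (Q? j)) ⟩
      ∑[ j < m ] (𝟙 (Q? j) * (2 * k * d !))
        ≤⟨ ∑-mono-≤ (λ j → 𝟙-*-mono (Q? j) heavy-weight) ⟩
      ∑[ j < m ] (𝟙 (Q? j) * (T * weight-at-ends j))
        ≡⟨ sum-cong-≗ (λ j → x∙yz≈y∙xz (𝟙 (Q? j)) T (weight-at-ends j)) ⟩
      ∑[ j < m ] (T * (𝟙 (Q? j) * weight-at-ends j))
        ≡⟨ *-distribˡ-sum T (λ j → 𝟙 (Q? j) * weight-at-ends j) ⟨
      T * ∑[ j < m ] (𝟙 (Q? j) * weight-at-ends j)
        ≡⟨ cong (T *_) (∑-endpoints (λ j → 𝟙 (Q? j)) weight) ⟩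
      T * ∑[ z < n ] (∑[ j < m ] (𝟙 (Q? j) * 𝟙 (z ∈ᵉ? e j)) * weight z)
        ≡⟨ cong (T *_) (sum-cong-≗ λ z → cong (_* weight z) (sum-cong-≗ λ j → sym (𝟙-× (Q? j) (z ∈ᵉ? e j)))) ⟩
      T * ∑[ z < n ] (loadWithin Q? z * weight z)
        ≤⟨ *-monoʳ-≤ T (∑-mono-≤ load*weight≤i*d!) ⟩
      T * ∑[ z < n ] (i z * d !)
        ≡⟨ cong (T *_) (*-distribʳ-sum (d !) i) ⟨
      T * (∑[ z < n ] i z * d !)
        ≤⟨ *-monoʳ-≤ T (*-monoˡ-≤ (d !) ∑i≤dk) ⟩
      T * (d * k * d !) ∎
      where
      open ≤-Reasoning
      weight-at-ends : Fin m → ℕ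
      weight-at-ends j = weight (src G (e j)) + weight (tgt G (e j))

    2*count+d*k≤2*d*d : 2 * count Q? + d * k ≤ 2 * (d * d)
    2*count+d*k≤2*d*d = begin
      2 * count Q? + d * k ≤⟨ +-monoˡ-≤ (d * k) 2*count≤T*d ⟩
      T * d + d * k        ≡⟨ cong (T * d +_) (*-comm d k) ⟩
      T * d + k * d        ≡⟨ *-distribʳ-+ d T k ⟨
      (T + k) * d          ≡⟨ cong (_* d) T+k≡2d ⟩
      2 * d * d            ≡⟨ *-assoc 2 d d ⟩
      2 * (d * d)          ∎
      where
      open ≤-Reasoning
      2*count≤T*d : 2 * count Q? ≤ T * d
      2*count≤T*d = *-cancelʳ-≤ _ _ (k * d !) {{m*n≢0 k (d !) {{>-nonZero 1≤k}} {{d !≢0}}}}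
        (subst₂ _≤_ (lhs (count Q?) k (d !)) (rhs T d k (d !)) weighted-count)
        where
        lhs : ∀ c k D → c * (2 * k * D) ≡ 2 * c * (k * D)
        lhs = solve-∀
        rhs : ∀ T d k D → T * (d * k * D) ≡ T * d * (k * D)
        rhs = solve-∀

LAdjacent : ∀ {n} (G : Graph n) → Edge G → Edge G → Set
LAdjacent G e f = DistinctEdges G e f × CloseEdges G e f

LAdjacent-sym : ∀ {n} (G : Graph n) e f → LAdjacent G e f → LAdjacent G f e
LAdjacent-sym G _ _ (distinct , x , y , x∈e , y∈f , x≈y) =
  (λ (s≡s , t≡t) → distinct (sym s≡s , sym t≡t)) ,
  y , x , y∈f , x∈e , [ (λ x≡y → inj₁ (sym x≡y)) , (λ x~y → inj₂ (Graph.sym G x~y)) ]′ x≈y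

IsLCliqueFamily : ∀ {n m} (G : Graph n) → (Fin m → Edge G) → Set
IsLCliqueFamily G e = ∀ {i j} → i ≢ j → LAdjacent G (e i) (e j)

module LClique {n m : ℕ} (G : Graph n) (e : Fin m → Edge G) (clique : IsLCliqueFamily G e)
               (u : Fin n) (u-max : ∀ z → EdgeFamily.load G e z ≤ EdgeFamily.load G e u) where
  open Edges G
  open EdgeFamily G e

  d k : ℕ
  d = maxDegree G
  k = load u

  Far : Fin m → Set
  Far j = ¬ Adj G u (src G (e j)) × ¬ Adj G u (tgt G (e j))

  Far? : Decidable Far
  Far? j = ¬? (adj? G u (src G (e j))) ×-dec ¬? (adj? G u (tgt G (e j)))

  far-¬adj : ∀ {j p} → Far j → p ∈ᵉ e j → ¬ Adj G u p
  far-¬adj (¬u~s , _) (inj₁ refl) = ¬u~s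
  far-¬adj (_ , ¬u~t) (inj₂ refl) = ¬u~t

  far⇒u∉ : ∀ {j} → Far j → ¬ u ∈ᵉ e j
  far⇒u∉ {j} far u∈e = far-¬adj far (opposite-∈ᵉ u (e j)) (opposite-adj u∈e)

  far≢at-u : ∀ {i j} → Far j → u ∈ᵉ e i → i ≢ j
  far≢at-u far u∈i refl = far⇒u∉ far u∈i

  far-avoids-N[u] : ∀ {j p} → Far j → p ∈ᵉ e j → ¬ (p ≡ u ⊎ Adj G u p)
  far-avoids-N[u] {j} far p∈e (inj₁ p≡u) = far⇒u∉ far (subst (_∈ᵉ e j) p≡u p∈e)
  far-avoids-N[u]     far p∈e (inj₂ u~p) = far-¬adj far p∈e u~p

  Linked : Fin n → Fin m → Set
  Linked z j = u ∈ᵉ e j × Adj G (opposite u (e j)) z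

  Linked? : ∀ z → Decidable (Linked z)
  Linked? z j = u ∈ᵉ? e j ×-dec adj? G (opposite u (e j)) z

  linked : Fin n → ℕ
  linked z = count (Linked? z)

  far-load+linked≤d : ∀ z → loadWithin Far? z + linked z ≤ d
  far-load+linked≤d z = begin
    loadWithin Far? z + linked z ≡⟨ count-∪ FarAt? (Linked? z) (λ (far , _) (u∈e , _) → far⇒u∉ far u∈e) ⟨
    count (FarAt? ∪? Linked? z)  ≤⟨ count-≤-injection (FarAt? ∪? Linked? z) (adj? G z) φ φ-adj φ-injective ⟩
    count (adj? G z)             ≤⟨ count-adj≤maxDegree z ⟩
    d                            ∎
    where
    open ≤-Reasoning
    FarAt? : Decidable (λ j → Far j × z ∈ᵉ e j)
    FarAt? j = Far? j ×-dec z ∈ᵉ? e j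

    φ : ∀ j → (Far j × z ∈ᵉ e j) ⊎ Linked z j → Fin n
    φ j (inj₁ _) = opposite z (e j)
    φ j (inj₂ _) = opposite u (e j)

    φ-adj : ∀ j p → Adj G z (φ j p)
    φ-adj j (inj₁ (_ , z∈e)) = opposite-adj z∈e
    φ-adj j (inj₂ (_ , o~z)) = Graph.sym G o~z

    φ-separates : ∀ {i j} → i ≢ j → ∀ p q → φ i p ≢ φ j q
    φ-separates i≢j (inj₁ (_ , z∈i)) (inj₁ (_ , z∈j)) o≡o = proj₁ (clique i≢j) (opposite-injective z∈i z∈j o≡o)
    φ-separates i≢j (inj₂ (u∈i , _)) (inj₂ (u∈j , _)) o≡o = proj₁ (clique i≢j) (opposite-injective u∈i u∈j o≡o)
    φ-separates {i} _ (inj₁ (far , _)) (inj₂ (u∈j , _)) o≡o =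
      far-avoids-N[u] far (opposite-∈ᵉ z (e i)) (inj₂ (subst (Adj G u) (sym o≡o) (opposite-adj u∈j)))
    φ-separates {j = j} _ (inj₂ (u∈i , _)) (inj₁ (far , _)) o≡o =
      far-avoids-N[u] far (opposite-∈ᵉ z (e j)) (inj₂ (subst (Adj G u) o≡o (opposite-adj u∈i)))

    φ-injective : ∀ {i j} p q → φ i p ≡ φ j q → i ≡ j
    φ-injective {i} {j} p q φ≡φ with i ≟ j
    ... | yes i≡j = i≡j
    ... | no  i≢j = ⊥-elim (φ-separates i≢j p q φ≡φ)

  far-reached-via-opposite : ∀ {i j} → Far j → u ∈ᵉ e i → CloseEdges G (e i) (e j) →
    Σ (Fin n) λ y → y ∈ᵉ e j × Adj G (opposite u (e i)) y
  far-reached-via-opposite {i} far u∈i (x , y , x∈i , y∈j , x≈y) with ∈ᵉ-opposite u∈i x∈i | x≈y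
  ... | inj₁ x≡u | inj₁ x≡y = ⊥-elim (far-avoids-N[u] far y∈j (inj₁ (trans (sym x≡y) x≡u)))
  ... | inj₁ x≡u | inj₂ x~y = ⊥-elim (far-avoids-N[u] far y∈j (inj₂ (subst (λ w → Adj G w y) x≡u x~y)))
  ... | inj₂ x≡o | inj₁ x≡y =
    ⊥-elim (far-avoids-N[u] far y∈j (inj₂ (subst (Adj G u) (trans (sym x≡o) x≡y) (opposite-adj u∈i))))
  ... | inj₂ x≡o | inj₂ x~y = y , y∈j , subst (λ w → Adj G w y) x≡o x~y

  far⇒linked-ends : ∀ {i j} → Far j → u ∈ᵉ e i →
    Linked (src G (e j)) i ⊎ Linked (tgt G (e j)) i
  far⇒linked-ends {i} far u∈i with far-reached-via-opposite far u∈i (proj₂ (clique (far≢at-u far u∈i)))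
  ... | y , inj₁ y≡s , o~y = inj₁ (u∈i , subst (Adj G (opposite u (e i))) y≡s o~y)
  ... | y , inj₂ y≡t , o~y = inj₂ (u∈i , subst (Adj G (opposite u (e i))) y≡t o~y)

  far⇒k≤linked : ∀ {j} → Far j → k ≤ linked (src G (e j)) + linked (tgt G (e j))
  far⇒k≤linked far = count-cover (λ i → u ∈ᵉ? e i) (Linked? _) (Linked? _) (far⇒linked-ends far)

  ∑linked≤d*k : ∑[ z < n ] linked z ≤ d * k
  ∑linked≤d*k = begin
    ∑[ z < n ] ∑[ i < m ] 𝟙 (Linked? z i)
      ≡⟨ ∑-comm (λ z i → 𝟙 (Linked? z i)) ⟩
    ∑[ i < m ] ∑[ z < n ] 𝟙 (Linked? z i)
      ≡⟨ sum-cong-≗ (λ i → trans (sum-cong-≗ λ z → 𝟙-× (u ∈ᵉ? e i) (adj? G (opposite u (e i)) z))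
                                 (sym (*-distribˡ-sum (𝟙 (u ∈ᵉ? e i)) (λ z → 𝟙 (adj? G (opposite u (e i)) z))))) ⟩
    ∑[ i < m ] (𝟙 (u ∈ᵉ? e i) * count (adj? G (opposite u (e i))))
      ≤⟨ ∑-mono-≤ (λ i → *-monoʳ-≤ (𝟙 (u ∈ᵉ? e i)) (count-adj≤maxDegree (opposite u (e i)))) ⟩
    ∑[ i < m ] (𝟙 (u ∈ᵉ? e i) * d)
      ≡⟨ *-distribʳ-sum d (λ i → 𝟙 (u ∈ᵉ? e i)) ⟨
    k * d
      ≡⟨ *-comm k d ⟩
    d * k ∎
    where open ≤-Reasoning

  k≤d : k ≤ d
  k≤d = begin
    k                             ≤⟨ count-mono (λ i → u ∈ᵉ? e i) (Linked? u) (λ u∈e → u∈e , Graph.sym G (opposite-adj u∈e)) ⟩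
    linked u                      ≤⟨ m≤n+m (linked u) (loadWithin Far? u) ⟩
    loadWithin Far? u + linked u  ≤⟨ far-load+linked≤d u ⟩
    d                             ∎
    where open ≤-Reasoning

  far-or-near : ∀ j → 1 ≤ 𝟙 (Far? j) + 1 * (𝟙 (adj? G u (src G (e j))) + 𝟙 (adj? G u (tgt G (e j))))
  far-or-near j with adj? G u (src G (e j)) | adj? G u (tgt G (e j))
  ... | yes _ | _     = s≤s z≤n
  ... | no _  | yes _ = s≤s z≤n
  ... | no _  | no _  = s≤s z≤n

  m≤far+d*k : m ≤ count Far? + d * k
  m≤far+d*k = begin
    m
      ≡⟨ ∑1≡n m ⟨
    ∑[ j < m ] 1
      ≤⟨ ∑-mono-≤ far-or-near ⟩
    ∑[ j < m ] (𝟙 (Far? j) + 1 * (u~ (src G (e j)) + u~ (tgt G (e j))))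
      ≡⟨ ∑-distrib-+ (λ j → 𝟙 (Far? j)) (λ j → 1 * (u~ (src G (e j)) + u~ (tgt G (e j)))) ⟩
    count Far? + ∑[ j < m ] (1 * (u~ (src G (e j)) + u~ (tgt G (e j))))
      ≡⟨ cong (count Far? +_) (∑-endpoints (λ _ → 1) u~) ⟩
    count Far? + ∑[ z < n ] (∑[ j < m ] (1 * 𝟙 (z ∈ᵉ? e j)) * u~ z)
      ≤⟨ +-monoʳ-≤ (count Far?) (∑-mono-≤ λ z → *-monoˡ-≤ (u~ z) (load≤k z)) ⟩
    count Far? + ∑[ z < n ] (k * u~ z)
      ≡⟨ cong (count Far? +_) (*-distribˡ-sum k u~) ⟨
    count Far? + k * count (adj? G u)
      ≤⟨ +-monoʳ-≤ (count Far?) (*-monoʳ-≤ k (count-adj≤maxDegree u)) ⟩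
    count Far? + k * d
      ≡⟨ cong (count Far? +_) (*-comm k d) ⟩
    count Far? + d * k ∎
    where
    open ≤-Reasoning
    u~ : Fin n → ℕ
    u~ z = 𝟙 (adj? G u z)
    load≤k : ∀ z → ∑[ j < m ] (1 * 𝟙 (z ∈ᵉ? e j)) ≤ k
    load≤k z = subst (_≤ k) (sum-cong-≗ λ j → sym (*-identityˡ (𝟙 (z ∈ᵉ? e j)))) (u-max z)

  2*m≤3*d*d : 1 ≤ k → 2 * m ≤ 3 * (d * d)
  2*m≤3*d*d 1≤k = begin
    2 * m                              ≤⟨ *-monoʳ-≤ 2 m≤far+d*k ⟩
    2 * (count Far? + d * k)           ≡⟨ distribute (count Far?) (d * k) ⟩
    2 * count Far? + d * k + d * k     ≤⟨ +-monoˡ-≤ (d * k) far-bound ⟩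
    2 * (d * d) + d * k                ≤⟨ +-monoʳ-≤ (2 * (d * d)) (*-monoʳ-≤ d k≤d) ⟩
    2 * (d * d) + d * d                ≡⟨ collect (d * d) ⟩
    3 * (d * d)                        ∎
    where
    open ≤-Reasoning
    far-bound : 2 * count Far? + d * k ≤ 2 * (d * d)
    far-bound = HeavyEdges.2*count+d*k≤2*d*d Far? linked 1≤k (≤-trans k≤d (m≤m+n d _))
      far-load+linked≤d far⇒k≤linked ∑linked≤d*k
    distribute : ∀ a b → 2 * (a + b) ≡ 2 * a + b + b
    distribute = solve-∀
    collect : ∀ a → 2 * a + a ≡ 3 * a
    collect = solve-∀

lcliqueFamily-bound : ∀ {n m} (G : Graph n) (e : Fin m → Edge G) → IsLCliqueFamily G e →
                      2 * m ≤ 3 * (maxDegree G * maxDegree G)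
lcliqueFamily-bound {m = zero} G e _ = z≤n
lcliqueFamily-bound {n} {suc m} G e clique = LClique.2*m≤3*d*d G e clique u u-max 1≤load-u
  where
  open Edges G using (_∈ᵉ?_)
  open EdgeFamily G e using (load)
  z₀ : Fin n
  z₀ = src G (e zero)
  u : Fin n
  u = argmax load z₀ (allFin n)
  u-max : ∀ z → load z ≤ load u
  u-max z = All.lookup (f[xs]≤f[argmax] {f = load} z₀ (allFin n)) (∈-allFin z)
  1≤load-u : 1 ≤ load u
  1≤load-u = ≤-trans (count-pos (λ j → z₀ ∈ᵉ? e j) (inj₁ refl)) (f[⊥]≤f[argmax] {f = load} z₀ (allFin n))

theorem2 : ∀ (n : ℕ) (G : Graph n) (C : List (Edge G)) →
    IsLClique G C → 2 * length C ≤ 3 * (maxDegree G * maxDegree G)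
theorem2 n G C clique = lcliqueFamily-bound G (lookup C) (lookup-pairwise (LAdjacent-sym G) clique)
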